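{- Let $n\ge2$, $a_1,\ldots,a_{n-1}$ positive integers, $\lambda=\sum a_i\omega_i$, and $E\in\mathbf R_p$. Then $x(E)_{i,j}>0$ for every $[i,j]\in E$. Moreover, if $d$ is a Dyck path with $S(x(E),d)=M(\lambda,d)$, then $[i,j]\in E$ for every peak or valley $(i,j)$ of $d$.
   Context: $U=\mathbb R^{\binom n2}$ with coordinates $x_{i,j}$, $1\le i<j\le n$. A Dyck path is a sequence $d=((i_1,j_1),\ldots,(i_N,j_N))$ of pairs with $1\le i_k<j_k\le n$, $j_1-i_1=j_N-i_N=1$, and each $(i_{k+1},j_{k+1})$ equal to $(i_k+1,j_k)$ or $(i_k,j_k+1)$. $S(x,d)=\sum_{(i,j)\in d}x_{i,j}$, $M(\lambda,d)=a_{i_1}+a_{i_1+1}+\ldots+a_{i_N}$. $(i,j)\in d$ is a peak if $(i,j-1),(i+1,j)\in d$ and a valley if $(i-1,j),(i,j+1)\in d$. $R$ is the set of segments $[i,j]$, integers $1\le i<j\le n$; $\mathbf R_p$ is the set of $E\subset R$ such that for any two segments in $E$ with nonempty intersection, the intersection belongs to $E$. $d^{i,j}=((i,i+1),\ldots,(i,j),(i+1,j),\ldots,(j-1,j))$; $x(E)$ is the unique point of $U$ with $x(E)_{i,j}=0$ if $[i,j]\notin E$ and $S(x(E),d^{i,j})=a_i+\ldots+a_{j-1}$ if $[i,j]\in E$. -}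

module Defs where

open import Data.Nat using (ℕ; zero; suc; _+_; _∸_; _≤_; _<_; _⊔_; _⊓_)
open import Data.Integer using (ℤ; +_) renaming (_+_ to _+ℤ_)
open import Data.Bool using (Bool; true; false)
open import Data.Product using (_×_; _,_; Σ; ∃)
open import Data.Sum using (_⊎_)
open import Data.Maybe using (Maybe; just; nothing)
open import Data.List using (List; []; _∷_; map; upTo; _++_; head; last)
open import Data.List.Relation.Unary.All using (All)
open import Data.List.Relation.Unary.Linked using (Linked)
open import Data.List.Membership.Propositional using (_∈_)
open import Relation.Binary.PropositionalEquality using (_≡_)

-- Indices are natural numbers; a pair (i , j) is a coordinate of U
-- (equivalently a segment [i,j] of R) when 1 ≤ i < j ≤ n.
Pair : Set
Pair = ℕ × ℕ

Valid : ℕ → Pair → Set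
Valid n (i , j) = (1 ≤ i) × (i < j) × (j ≤ n)

Step : Pair → Pair → Set
Step (i , j) (i' , j') = (i' ≡ suc i × j' ≡ j) ⊎ (i' ≡ i × j' ≡ suc j)

Diag : Pair → Set
Diag (i , j) = j ≡ suc i

IsDyck : ℕ → List Pair → Set
IsDyck n d =
  All (Valid n) d × Linked Step d
  × (Σ Pair λ p → head d ≡ just p × Diag p)
  × (Σ Pair λ q → last d ≡ just q × Diag q)

-- points of U: x (i , j) for 1 ≤ i < j ≤ n (other values are irrelevant)
Point : Set
Point = ℕ → ℕ → ℤ

sumℤ : List ℤ → ℤ
sumℤ [] = + 0
sumℤ (z ∷ zs) = z +ℤ sumℤ zs

S : Point → List Pair → ℤ
S x d = sumℤ (map (λ p → x (Data.Product.proj₁ p) (Data.Product.proj₂ p)) d)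

sumFrom : (ℕ → ℕ) → ℕ → ℕ → ℕ
sumFrom a lo zero = 0
sumFrom a lo (suc len) = a lo + sumFrom a (suc lo) len

lastFst : ℕ → List Pair → ℕ
lastFst i [] = i
lastFst _ ((i' , _) ∷ ps) = lastFst i' ps

-- M(λ,d) = a_{i_1} + a_{i_1+1} + … + a_{i_N}
M : (ℕ → ℕ) → List Pair → ℕ
M a [] = 0
M a ((i , j) ∷ ps) = sumFrom a i (suc (lastFst i ps ∸ i))

-- d^{i,j} = ((i,i+1),…,(i,j),(i+1,j),…,(j-1,j))
hook : ℕ → ℕ → List Pair
hook i j = map (λ t → (i , suc i + t)) (upTo (j ∸ i))
        ++ map (λ t → (suc i + t , j)) (upTo (j ∸ i ∸ 1))

-- E ⊂ R, given as a (decidable) Boolean membership function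
InR : ℕ → (ℕ → ℕ → Bool) → Set
InR n E = ∀ i j → E i j ≡ true → Valid n (i , j)

-- E ∈ R_p: any two segments of E with nonempty intersection
-- [i,j] ∩ [k,l] = [max i k , min j l] have their intersection in E
InRp : (ℕ → ℕ → Bool) → Set
InRp E = ∀ i j k l → E i j ≡ true → E k l ≡ true →
         (i ⊔ k) ≤ (j ⊓ l) → E (i ⊔ k) (j ⊓ l) ≡ true

IsXE : ℕ → (ℕ → ℕ) → (ℕ → ℕ → Bool) → Point → Set
IsXE n a E x =
  (∀ i j → Valid n (i , j) → E i j ≡ false → x i j ≡ + 0)
  × (∀ i j → E i j ≡ true → S x (hook i j) ≡ + sumFrom a i (j ∸ i))

Peak : List Pair → ℕ → ℕ → Set
Peak d i j = ((i , j) ∈ d) × ((i , j ∸ 1) ∈ d) × ((suc i , j) ∈ d)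

Valley : List Pair → ℕ → ℕ → Set
Valley d i j = ((i , j) ∈ d) × ((i ∸ 1 , j) ∈ d) × ((i , suc j) ∈ d)

{-# OPTIONS --safe #-}
-- Write P s = a₀ + ⋯ + a_{s−1} and, along row k and column l,
--   row k c = P k + x_{k,k+1} + ⋯ + x_{k,c},    col l r = P l − x_{r,l} − ⋯ − x_{l−1,l}.
-- The hook equation S(x, d^{k,l}) = a_k + ⋯ + a_{l−1} says row k l = col l (k+1), so each
-- [k,l] ∈ E carries the interval [row k (l−1), row k l] = [col l k, col l (k+1)] of length x_{k,l}.
--
-- Positivity, by induction on j − i: entries off E vanish, so x_{i,j} = col j r − row i c where
-- c < j is the last right end of a segment [i,c] ∈ E (or c = i) and r > i is the first left end
-- of a segment [r,j] ∈ E (or r = j). If c < r this is at least P r − P c > 0; c = r would put the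
-- point [i,c] ∩ [r,j] into E; and if r < c then [r,c] ∈ E and row i c ≤ col c r < row r c ≤ col j r.
--
-- Along a Dyck path from (p,p+1) to (u,u+1) the intervals of its segments in E come in increasing
-- order inside [P p, P (u+1)], so S(x,d) telescopes to at most P (u+1) − P p = M(λ,d). At a peak or
-- valley outside E the segments of E before and after it are strictly separated in both coordinates,
-- which leaves a strict gap between consecutive intervals.

module Submission where

open import Defs
open import Data.Nat using (ℕ; zero; suc; pred; _+_; _∸_; _≤_; _<_; _≤′_; ≤′-refl; ≤′-step; z≤n; s≤s)
open import Data.Nat.Properties
  using (≤-refl; ≤-trans; ≤-pred; <-trans; ≤-<-trans; <-≤-trans; <⇒≤; <-irrefl; ≤-reflexive; <-cmp;
         n<1+n; n≤1+n; m≤n⇒m≤1+n; m≤m+n; m<m+n; +-comm; +-assoc; +-suc; +-identityʳ;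
         m+[n∸m]≡n; +-∸-assoc; ∸-+-assoc; n∸n≡0; ≤⇒≤′; ≤′⇒≤; <⇒≤pred; m≤n⇒m<n∨m≡n;
         ∸-monoˡ-≤; ∸-monoʳ-≤; ∸-monoˡ-<; ∸-monoʳ-<; m≤n⇒m⊔n≡n; m≤n⇒m⊓n≡m; pred[n]≤n)
open import Data.Nat.Induction using (<-rec)
open import Data.Integer using (ℤ; +_; 0ℤ; +≤+; +<+)
  renaming (suc to sucℤ; _+_ to _+ℤ_; _-_ to _-ℤ_; _≤_ to _≤ℤ_; _<_ to _<ℤ_)
import Data.Integer.Properties as ℤP
open import Data.Integer.Tactic.RingSolver using (solve-∀)
open import Algebra.Properties.AbelianGroup ℤP.+-0-abelianGroup using (∙-cancelʳ)
open import Data.Bool using (Bool; true; false)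
import Data.Bool.Properties as BoolP
open import Data.Empty using (⊥-elim)
open import Data.Product using (_×_; _,_; proj₁; proj₂; ∃-syntax; ∃₂)
open import Data.Sum using (_⊎_; inj₁; inj₂; [_,_])
open import Data.Maybe using (just)
open import Data.List using (List; []; _∷_; map; applyUpTo; upTo; _++_; last; filter)
open import Data.List.Properties using (map-++; filter-++; filter-reject)
open import Data.List.Membership.Propositional using (_∈_)
open import Data.List.Membership.Propositional.Properties using (∈-++⁺ˡ; ∈-++⁺ʳ; ∈-∃++; ∈-filter⁻)
open import Data.List.Relation.Unary.All using (All; []; _∷_)
import Data.List.Relation.Unary.All as All
open import Data.List.Relation.Unary.All.Properties using (++⁻ʳ; all-filter)
open import Data.List.Relation.Unary.AllPairs using (AllPairs; []; _∷_)
import Data.List.Relation.Unary.AllPairs as AllPairs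
import Data.List.Relation.Unary.AllPairs.Properties as AllPairsP
open import Data.List.Relation.Unary.Any using (here; there)
import Data.List.Relation.Unary.Linked as Linked
open import Data.List.Relation.Unary.Linked.Properties using (Linked⇒AllPairs)
open import Relation.Nullary using (¬_; yes; no)
open import Relation.Binary.Definitions using (tri<; tri≈; tri>)
open import Relation.Unary using (Decidable)
open import Relation.Binary.PropositionalEquality
  using (_≡_; refl; sym; trans; cong; cong₂; subst; subst₂; module ≡-Reasoning)

-- Sums

sumFrom-+ : ∀ (a : ℕ → ℕ) lo m m′ → sumFrom a lo (m + m′) ≡ sumFrom a lo m + sumFrom a (lo + m) m′
sumFrom-+ a lo zero    m′ = cong (λ s → sumFrom a s m′) (sym (+-identityʳ lo))
sumFrom-+ a lo (suc m) m′ = begin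
  a lo + sumFrom a (suc lo) (m + m′)                            ≡⟨ cong (_+_ (a lo)) (sumFrom-+ a (suc lo) m m′) ⟩
  a lo + (sumFrom a (suc lo) m + sumFrom a (suc lo + m) m′)     ≡⟨ sym (+-assoc (a lo) _ _) ⟩
  a lo + sumFrom a (suc lo) m + sumFrom a (suc lo + m) m′       ≡⟨ cong (λ s → a lo + sumFrom a (suc lo) m + sumFrom a s m′) (sym (+-suc lo m)) ⟩
  a lo + sumFrom a (suc lo) m + sumFrom a (lo + suc m) m′       ∎
  where open ≡-Reasoning

sumFrom-mono : ∀ (a : ℕ → ℕ) lo {s t} → s ≤ t → sumFrom a lo s ≤ sumFrom a lo t
sumFrom-mono a lo {s} {t} s≤t = begin
  sumFrom a lo s                               ≤⟨ m≤m+n _ _ ⟩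
  sumFrom a lo s + sumFrom a (lo + s) (t ∸ s)  ≡⟨ sym (sumFrom-+ a lo s (t ∸ s)) ⟩
  sumFrom a lo (s + (t ∸ s))                   ≡⟨ cong (sumFrom a lo) (m+[n∸m]≡n s≤t) ⟩
  sumFrom a lo t                               ∎
  where open Data.Nat.Properties.≤-Reasoning

sumFrom-strict : ∀ (a : ℕ → ℕ) lo {s t} → s < t → 0 < a (lo + s) → sumFrom a lo s < sumFrom a lo t
sumFrom-strict a lo {s} {t} s<t a>0 = begin-strict
  sumFrom a lo s                       <⟨ m<m+n _ (<-≤-trans a>0 (m≤m+n _ 0)) ⟩
  sumFrom a lo s + (a (lo + s) + 0)    ≡⟨ sym (sumFrom-+ a lo s 1) ⟩
  sumFrom a lo (s + 1)                 ≡⟨ cong (sumFrom a lo) (+-comm s 1) ⟩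
  sumFrom a lo (suc s)                 ≤⟨ sumFrom-mono a lo s<t ⟩
  sumFrom a lo t                       ∎
  where open Data.Nat.Properties.≤-Reasoning

≤pred⇒< : ∀ {m l t} → m < l → t ≤ pred l → t < l
≤pred⇒< {l = suc l} _ t≤l = s≤s t≤l

sumℤ-++ : ∀ xs ys → sumℤ (xs ++ ys) ≡ sumℤ xs +ℤ sumℤ ys
sumℤ-++ []       ys = sym (ℤP.+-identityˡ (sumℤ ys))
sumℤ-++ (z ∷ xs) ys = trans (cong (z +ℤ_) (sumℤ-++ xs ys)) (sym (ℤP.+-assoc z (sumℤ xs) (sumℤ ys)))

sumFromℤ : (ℕ → ℤ) → ℕ → ℕ → ℤ
sumFromℤ f lo zero      = 0ℤ
sumFromℤ f lo (suc len) = f lo +ℤ sumFromℤ f (suc lo) len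

sumFromℤ-snoc : ∀ f lo len → sumFromℤ f lo (suc len) ≡ sumFromℤ f lo len +ℤ f (lo + len)
sumFromℤ-snoc f lo zero = begin
  f lo +ℤ 0ℤ        ≡⟨ ℤP.+-comm (f lo) 0ℤ ⟩
  0ℤ +ℤ f lo        ≡⟨ cong (λ t → 0ℤ +ℤ f t) (sym (+-identityʳ lo)) ⟩
  0ℤ +ℤ f (lo + 0)  ∎
  where open ≡-Reasoning
sumFromℤ-snoc f lo (suc len) = begin
  f lo +ℤ sumFromℤ f (suc lo) (suc len)                   ≡⟨ cong (f lo +ℤ_) (sumFromℤ-snoc f (suc lo) len) ⟩
  f lo +ℤ (sumFromℤ f (suc lo) len +ℤ f (suc lo + len))   ≡⟨ sym (ℤP.+-assoc (f lo) _ _) ⟩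
  f lo +ℤ sumFromℤ f (suc lo) len +ℤ f (suc lo + len)     ≡⟨ cong (λ t → f lo +ℤ sumFromℤ f (suc lo) len +ℤ f t) (sym (+-suc lo len)) ⟩
  f lo +ℤ sumFromℤ f (suc lo) len +ℤ f (lo + suc len)     ∎
  where open ≡-Reasoning

S-++ : ∀ (x : Point) xs ys → S x (xs ++ ys) ≡ S x xs +ℤ S x ys
S-++ x xs ys = trans (cong sumℤ (map-++ _ xs ys)) (sumℤ-++ (map _ xs) (map _ ys))

S-map-applyUpTo : ∀ (x : Point) (φ : ℕ → Pair) g f lo len →
  (∀ t → x (proj₁ (φ (g t))) (proj₂ (φ (g t))) ≡ f (lo + t)) →
  S x (map φ (applyUpTo g len)) ≡ sumFromℤ f lo len
S-map-applyUpTo x φ g f lo zero      _  = refl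
S-map-applyUpTo x φ g f lo (suc len) eq = cong₂ _+ℤ_
  (trans (eq 0) (cong f (+-identityʳ lo)))
  (S-map-applyUpTo x φ (λ t → g (suc t)) f (suc lo) len (λ t → trans (eq (suc t)) (cong f (+-suc lo t))))

S-hook : ∀ (x : Point) i j →
  S x (hook i j) ≡ sumFromℤ (x i) (suc i) (j ∸ i) +ℤ sumFromℤ (λ t → x t j) (suc i) (j ∸ i ∸ 1)
S-hook x i j = trans (S-++ x (map arm (upTo (j ∸ i))) (map leg (upTo (j ∸ i ∸ 1))))
  (cong₂ _+ℤ_ (S-map-applyUpTo x arm (λ t → t) (x i) (suc i) (j ∸ i) (λ _ → refl))
              (S-map-applyUpTo x leg (λ t → t) (λ t → x t j) (suc i) (j ∸ i ∸ 1) (λ _ → refl)))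
  where
  arm leg : ℕ → Pair
  arm t = (i , suc i + t)
  leg t = (suc i + t , j)

0<-of-+ : ∀ {i j k} → i +ℤ k ≡ j → i <ℤ j → 0ℤ <ℤ k
0<-of-+ {i} {k = k} refl i<i+k = ℤP.≰⇒> λ k≤0 → ℤP.<⇒≱ i<i+k (begin
  i +ℤ k   ≤⟨ ℤP.+-monoʳ-≤ i k≤0 ⟩
  i +ℤ 0ℤ  ≡⟨ ℤP.+-identityʳ i ⟩
  i        ∎)
  where open ℤP.≤-Reasoning

≤-+-nonneg : ∀ {i j} → 0ℤ ≤ℤ j → i ≤ℤ i +ℤ j
≤-+-nonneg {i} 0≤j = ℤP.≤-trans (ℤP.≤-reflexive (sym (ℤP.+-identityʳ i))) (ℤP.+-monoʳ-≤ i 0≤j)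

-- Telescoping

module Telescope {A : Set} (lo hi : A → ℤ) where

  gain : A → ℤ
  gain e = hi e -ℤ lo e

  Σgain : List A → ℤ
  Σgain es = sumℤ (map gain es)

  Chain : List A → Set
  Chain = AllPairs (λ e f → hi e ≤ℤ lo f)

  private
    absorb : ∀ {b} e s → b ≤ℤ lo e → b +ℤ (gain e +ℤ s) ≤ℤ hi e +ℤ s
    absorb {b} e s b≤lo = begin
      b +ℤ (gain e +ℤ s)           ≡⟨ regroup b (lo e) (hi e) s ⟩
      (b -ℤ lo e) +ℤ (hi e +ℤ s)   ≤⟨ ℤP.+-monoˡ-≤ (hi e +ℤ s) (ℤP.i≤j⇒i-j≤0 b≤lo) ⟩
      0ℤ +ℤ (hi e +ℤ s)            ≡⟨ ℤP.+-identityˡ _ ⟩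
      hi e +ℤ s                    ∎
      where
      open ℤP.≤-Reasoning
      regroup : ∀ b l h s → b +ℤ ((h -ℤ l) +ℤ s) ≡ (b -ℤ l) +ℤ (h +ℤ s)
      regroup = solve-∀

  telescope : ∀ {b t} es → Chain es → b ≤ℤ t →
    (∀ {e} → e ∈ es → b ≤ℤ lo e × hi e ≤ℤ t) → b +ℤ Σgain es ≤ℤ t
  telescope {b} []       _              b≤t _      = ℤP.≤-trans (ℤP.≤-reflexive (ℤP.+-identityʳ b)) b≤t
  telescope {b} {t} (e ∷ es) (e≤es ∷ chain) _ bounds = begin
    b +ℤ (gain e +ℤ Σgain es)  ≤⟨ absorb e (Σgain es) (proj₁ (bounds (here refl))) ⟩
    hi e +ℤ Σgain es           ≤⟨ telescope es chain (proj₂ (bounds (here refl)))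
                                    (λ f∈ → All.lookup e≤es f∈ , proj₂ (bounds (there f∈))) ⟩
    t                          ∎
    where open ℤP.≤-Reasoning

  telescope-< : ∀ {b t} es fs → Chain (es ++ fs) → b <ℤ t →
    (∀ {e} → e ∈ es → b ≤ℤ lo e × hi e <ℤ t) →
    (∀ {f} → f ∈ fs → b <ℤ lo f × hi f ≤ℤ t) →
    (∀ {e f} → e ∈ es → f ∈ fs → hi e <ℤ lo f) →
    b +ℤ Σgain (es ++ fs) <ℤ t
  telescope-< {b} {t} [] fs chain b<t _ fs-bounds _ = begin-strict
    b +ℤ Σgain fs          <⟨ ℤP.+-monoˡ-< (Σgain fs) (ℤP.suc[i]≤j⇒i<j {i = b} ℤP.≤-refl) ⟩
    sucℤ b +ℤ Σgain fs     ≤⟨ telescope fs chain (ℤP.i<j⇒suc[i]≤j b<t)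
                                (λ f∈ → ℤP.i<j⇒suc[i]≤j (proj₁ (fs-bounds f∈)) , proj₂ (fs-bounds f∈)) ⟩
    t                      ∎
    where open ℤP.≤-Reasoning
  telescope-< {b} {t} (e ∷ es) fs (e≤rest ∷ chain) _ es-bounds fs-bounds cross = begin-strict
    b +ℤ (gain e +ℤ Σgain (es ++ fs))  ≤⟨ absorb e _ (proj₁ (es-bounds (here refl))) ⟩
    hi e +ℤ Σgain (es ++ fs)           <⟨ telescope-< es fs chain (proj₂ (es-bounds (here refl)))
                                            (λ e′∈ → All.lookup e≤rest (∈-++⁺ˡ e′∈) , proj₂ (es-bounds (there e′∈)))
                                            (λ f∈ → cross (here refl) f∈ , proj₂ (fs-bounds f∈))
                                            (λ e′∈ f∈ → cross (there e′∈) f∈) ⟩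
    t                                  ∎
    where open ℤP.≤-Reasoning

-- Dyck paths

rank : Pair → ℕ
rank (k , l) = k + l

_≼_ : Pair → Pair → Set
(k , l) ≼ (k′ , l′) = k ≤ k′ × l ≤ l′

_≺_ : Pair → Pair → Set
e ≺ f = e ≼ f × rank e < rank f

_≪_ : Pair → Pair → Set
(k , l) ≪ (k′ , l′) = k < k′ × l < l′

≼-refl : ∀ {e} → e ≼ e
≼-refl = ≤-refl , ≤-refl

≺-trans : ∀ {e f g} → e ≺ f → f ≺ g → e ≺ g
≺-trans {_ , _} {_ , _} {_ , _} ((k≤ , l≤) , r<) ((k≤′ , l≤′) , r<′) = (≤-trans k≤ k≤′ , ≤-trans l≤ l≤′) , <-trans r< r<′

≼-≪-≼ : ∀ {e f g h} → e ≼ f → f ≪ g → g ≼ h → e ≪ h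
≼-≪-≼ {_ , _} {_ , _} {_ , _} {_ , _} (k≤ , l≤) (k< , l<) (k≤′ , l≤′) =
  ≤-<-trans k≤ (<-≤-trans k< k≤′) , ≤-<-trans l≤ (<-≤-trans l< l≤′)

Step⇒≺ : ∀ {e f} → Step e f → e ≺ f
Step⇒≺ {i , j} (inj₁ (refl , refl)) = (n≤1+n i , ≤-refl) , n<1+n (i + j)
Step⇒≺ {i , j} (inj₂ (refl , refl)) = (≤-refl , n≤1+n j) , subst (i + j <_) (sym (+-suc i j)) (n<1+n (i + j))

AllPairs-comparable : ∀ {A : Set} {R : A → A → Set} {xs u v} → AllPairs R xs → u ∈ xs → v ∈ xs →
  u ≡ v ⊎ R u v ⊎ R v u
AllPairs-comparable (_ ∷ _)  (here refl) (here refl) = inj₁ refl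
AllPairs-comparable (ru ∷ _) (here refl) (there v∈)  = inj₂ (inj₁ (All.lookup ru v∈))
AllPairs-comparable (rv ∷ _) (there u∈)  (here refl) = inj₂ (inj₂ (All.lookup rv u∈))
AllPairs-comparable (_ ∷ rs) (there u∈)  (there v∈)  = AllPairs-comparable rs u∈ v∈

AllPairs-pivot : ∀ {A : Set} {R : A → A → Set} xs {v ys} → AllPairs R (xs ++ v ∷ ys) →
  All (λ u → R u v) xs × All (R v) ys
AllPairs-pivot []       (rv ∷ _)  = [] , rv
AllPairs-pivot (u ∷ xs) (ru ∷ rs) with All.head (++⁻ʳ xs ru) | AllPairs-pivot xs rs
... | ruv | before , after = ruv ∷ before , after

≼-of-rank : ∀ {d e f} → AllPairs _≺_ d → e ∈ d → f ∈ d → rank e ≤ rank f → e ≼ f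
≼-of-rank ord e∈ f∈ e≤f with AllPairs-comparable ord e∈ f∈
... | inj₁ refl               = ≼-refl
... | inj₂ (inj₁ (e≼f , _))   = e≼f
... | inj₂ (inj₂ (_ , f<e))   = ⊥-elim (<-irrefl refl (<-≤-trans f<e e≤f))

last-∈ : ∀ {A : Set} (d : List A) {q} → last d ≡ just q → q ∈ d
last-∈ (_ ∷ [])         refl = here refl
last-∈ (_ ∷ d@(_ ∷ _))  eq   = there (last-∈ d eq)

≼-last : ∀ d {e q} → AllPairs _≺_ d → last d ≡ just q → e ∈ d → e ≼ q
≼-last (_ ∷ [])         _         refl (here refl) = ≼-refl
≼-last (_ ∷ d@(_ ∷ _))  (e≺ ∷ _)  eq   (here refl) = proj₁ (All.lookup e≺ (last-∈ d eq))
≼-last (_ ∷ d@(_ ∷ _))  (_ ∷ ord) eq   (there e∈)  = ≼-last d ord eq e∈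

lastFst-last : ∀ {i j} t {u v} → last ((i , j) ∷ t) ≡ just (u , v) → lastFst i t ≡ u
lastFst-last []              refl = refl
lastFst-last ((_ , _) ∷ t)   eq   = lastFst-last t eq

record Span (n : ℕ) (d : List Pair) : Set where
  field
    from to  : ℕ
    1≤from   : 1 ≤ from
    from≤to  : from ≤ to
    to<n     : to < n
    valid    : All (Valid n) d
    ordered  : AllPairs _≺_ d
    within   : ∀ {e} → e ∈ d → from ≤ proj₁ e × proj₂ e ≤ suc to
    M-span   : ∀ a → M a d ≡ sumFrom a from (suc (to ∸ from))

span : ∀ {n d} → IsDyck n d → Span n d
span {n} {(p , _) ∷ t} (valid , steps , ((_ , _) , refl , refl) , ((u , _) , lst , refl)) = record
  { from    = p
  ; to      = u
  ; 1≤from  = proj₁ (All.head valid)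
  ; from≤to = proj₁ (first≼ (last-∈ _ lst))
  ; to<n    = proj₂ (proj₂ (All.lookup valid (last-∈ _ lst)))
  ; valid   = valid
  ; ordered = ordered
  ; within  = λ e∈ → proj₁ (first≼ e∈) , proj₂ (≼-last _ ordered lst e∈)
  ; M-span  = λ a → cong (λ w → sumFrom a p (suc (w ∸ p))) (lastFst-last t lst)
  }
  where
  ordered : AllPairs _≺_ ((p , suc p) ∷ t)
  ordered = Linked⇒AllPairs ≺-trans (Linked.map Step⇒≺ steps)
  first≼ : ∀ {e} → e ∈ (p , suc p) ∷ t → (p , suc p) ≼ e
  first≼ (here refl) = ≼-refl
  first≼ (there e∈)  = proj₁ (All.lookup (AllPairs.head ordered) e∈)

record Corner (d : List Pair) (v : Pair) : Set where
  field
    before after  : Pair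
    before∈       : before ∈ d
    after∈        : after ∈ d
    before≪after  : before ≪ after
    rank-before   : suc (rank before) ≡ rank v
    rank-after    : rank after ≡ suc (rank v)

corner : ∀ {d i j} → 1 ≤ i → i < j → Peak d i j ⊎ Valley d i j → Corner d (i , j)
corner {i = i} {j = suc j} _ _ (inj₁ (_ , before∈ , after∈)) = record
  { before = i , j ; after = suc i , suc j ; before∈ = before∈ ; after∈ = after∈
  ; before≪after = n<1+n i , n<1+n j ; rank-before = sym (+-suc i j) ; rank-after = refl }
corner {i = suc i} {j = j} _ _ (inj₂ (_ , before∈ , after∈)) = record
  { before = i , j ; after = suc i , suc j ; before∈ = before∈ ; after∈ = after∈
  ; before≪after = n<1+n i , n<1+n j ; rank-before = refl ; rank-after = cong suc (+-suc i j) }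

split-at-corner : ∀ {d v} → AllPairs _≺_ d → v ∈ d → (c : Corner d v) → let open Corner c in
  ∃₂ λ pre post → d ≡ pre ++ v ∷ post × All (_≼ before) pre × All (after ≼_) post
split-at-corner {v = v} ordered v∈ c with ∈-∃++ v∈
... | pre , post , refl with AllPairs-pivot pre ordered
... | pre≺v , v≺post = pre , post , refl
    , All.tabulate (λ e∈ → ≼-of-rank ordered (∈-++⁺ˡ e∈) before∈
                             (≤-pred (≤-trans (proj₂ (All.lookup pre≺v e∈)) (≤-reflexive (sym rank-before)))))
    , All.tabulate (λ f∈ → ≼-of-rank ordered after∈ (∈-++⁺ʳ pre (there f∈))
                             (≤-trans (≤-reflexive rank-after) (proj₂ (All.lookup v≺post f∈))))
  where open Corner c

-- Partial sums along rows and columns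

module Potentials (a : ℕ → ℕ) (x : Point) where

  -- a 0 is unconstrained; it cancels from every difference P t − P s used below.
  P : ℕ → ℤ
  P s = + sumFrom a 0 s

  P-span : ∀ {s t} → s ≤ t → P s +ℤ + sumFrom a s (t ∸ s) ≡ P t
  P-span {s} {t} s≤t = begin
    P s +ℤ + sumFrom a s (t ∸ s)             ≡⟨ sym (ℤP.pos-+ (sumFrom a 0 s) _) ⟩
    + (sumFrom a 0 s + sumFrom a s (t ∸ s))  ≡⟨ cong +_ (sym (sumFrom-+ a 0 s (t ∸ s))) ⟩
    + sumFrom a 0 (s + (t ∸ s))              ≡⟨ cong (λ m → + sumFrom a 0 m) (m+[n∸m]≡n s≤t) ⟩
    P t                                      ∎
    where open ≡-Reasoning

  P-mono : ∀ {s t} → s ≤ t → P s ≤ℤ P t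
  P-mono s≤t = +≤+ (sumFrom-mono a 0 s≤t)

  P-< : ∀ {s t} → s < t → 0 < a s → P s <ℤ P t
  P-< s<t a>0 = +<+ (sumFrom-strict a 0 s<t a>0)

  row : ℕ → ℕ → ℤ
  row k c = P k +ℤ sumFromℤ (x k) (suc k) (c ∸ k)

  col : ℕ → ℕ → ℤ
  col l r = P l -ℤ sumFromℤ (λ t → x t l) r (l ∸ r)

  row-base : ∀ k → row k k ≡ P k
  row-base k = trans (cong (λ m → P k +ℤ sumFromℤ (x k) (suc k) m) (n∸n≡0 k)) (ℤP.+-identityʳ (P k))

  col-base : ∀ l → col l l ≡ P l
  col-base l = trans (cong (λ m → P l -ℤ sumFromℤ (λ t → x t l) l m) (n∸n≡0 l)) (ℤP.+-identityʳ (P l))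

  row-step : ∀ {k c} → k ≤ c → row k (suc c) ≡ row k c +ℤ x k (suc c)
  row-step {k} {c} k≤c = begin
    P k +ℤ Σ (suc c ∸ k)                      ≡⟨ cong (λ m → P k +ℤ Σ m) (+-∸-assoc 1 k≤c) ⟩
    P k +ℤ Σ (suc (c ∸ k))                    ≡⟨ cong (P k +ℤ_) (sumFromℤ-snoc (x k) (suc k) (c ∸ k)) ⟩
    P k +ℤ (Σ (c ∸ k) +ℤ x k (suc k + (c ∸ k)))  ≡⟨ sym (ℤP.+-assoc (P k) (Σ (c ∸ k)) _) ⟩
    row k c +ℤ x k (suc (k + (c ∸ k)))        ≡⟨ cong (λ t → row k c +ℤ x k (suc t)) (m+[n∸m]≡n k≤c) ⟩
    row k c +ℤ x k (suc c)                    ∎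
    where
    open ≡-Reasoning
    Σ : ℕ → ℤ
    Σ = sumFromℤ (x k) (suc k)

  col-step : ∀ {l r} → r < l → col l (suc r) ≡ col l r +ℤ x r l
  col-step {suc l} {r} (s≤s r≤l) = begin
    P (suc l) -ℤ Σ                        ≡⟨ regroup (P (suc l)) (x r (suc l)) Σ ⟩
    P (suc l) -ℤ (x r (suc l) +ℤ Σ) +ℤ x r (suc l)
                                          ≡⟨ cong (λ m → P (suc l) -ℤ sumFromℤ (λ t → x t (suc l)) r m +ℤ x r (suc l))
                                                  (sym (+-∸-assoc 1 r≤l)) ⟩
    col (suc l) r +ℤ x r (suc l)          ∎
    where
    open ≡-Reasoning
    Σ : ℤ
    Σ = sumFromℤ (λ t → x t (suc l)) (suc r) (l ∸ r)
    regroup : ∀ p y s → p -ℤ s ≡ p -ℤ (y +ℤ s) +ℤ y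
    regroup = solve-∀

  row-mono : ∀ {k c c′} → (∀ {t} → c < t → t ≤ c′ → 0ℤ ≤ℤ x k t) → k ≤ c → c ≤ c′ → row k c ≤ℤ row k c′
  row-mono {k} {c} nonneg k≤c c≤c′ = go nonneg (≤⇒≤′ c≤c′)
    where
    go : ∀ {c′} → (∀ {t} → c < t → t ≤ c′ → 0ℤ ≤ℤ x k t) → c ≤′ c′ → row k c ≤ℤ row k c′
    go _ ≤′-refl = ℤP.≤-refl
    go {suc c′} nonneg (≤′-step c≤′c′) = ℤP.≤-trans
      (go (λ c<t t≤c′ → nonneg c<t (m≤n⇒m≤1+n t≤c′)) c≤′c′)
      (ℤP.≤-trans (≤-+-nonneg (nonneg (s≤s (≤′⇒≤ c≤′c′)) ≤-refl))
                  (ℤP.≤-reflexive (sym (row-step (≤-trans k≤c (≤′⇒≤ c≤′c′))))))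

  col-mono : ∀ {l r r′} → (∀ {t} → r ≤ t → t < r′ → 0ℤ ≤ℤ x t l) → r ≤ r′ → r′ ≤ l → col l r ≤ℤ col l r′
  col-mono {l} {r} nonneg r≤r′ r′≤l = go nonneg (≤⇒≤′ r≤r′) r′≤l
    where
    go : ∀ {r′} → (∀ {t} → r ≤ t → t < r′ → 0ℤ ≤ℤ x t l) → r ≤′ r′ → r′ ≤ l → col l r ≤ℤ col l r′
    go _ ≤′-refl _ = ℤP.≤-refl
    go {suc r′} nonneg (≤′-step r≤′r′) r′<l = ℤP.≤-trans
      (go (λ r≤t t<r′ → nonneg r≤t (m≤n⇒m≤1+n t<r′)) r≤′r′ (<⇒≤ r′<l))
      (ℤP.≤-trans (≤-+-nonneg (nonneg (≤′⇒≤ r≤′r′) ≤-refl))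
                  (ℤP.≤-reflexive (sym (col-step r′<l))))

-- The point x(E)

_⊏_ : Pair → Pair → Set
(k , l) ⊏ (i , j) = i ≤ k × l ≤ j × (i < k ⊎ l < j)

⊏-shorter : ∀ {k l i j} → k ≤ l → (k , l) ⊏ (i , j) → l ∸ k < j ∸ i
⊏-shorter {k} {l} {i} {j} k≤l (i≤k , l≤j , inj₁ i<k) = <-≤-trans (∸-monoʳ-< i<k k≤l) (∸-monoˡ-≤ i l≤j)
⊏-shorter {k} {l} {i} {j} k≤l (i≤k , l≤j , inj₂ l<j) = ≤-<-trans (∸-monoʳ-≤ l i≤k) (∸-monoˡ-< l<j (≤-trans i≤k k≤l))

⊏-widen : ∀ {k l i j i′ j′} → i ≤ i′ → j′ ≤ j → (k , l) ⊏ (i′ , j′) → (k , l) ⊏ (i , j)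
⊏-widen i≤i′ j′≤j (i′≤k , l≤j′ , strict) =
  ≤-trans i≤i′ i′≤k , ≤-trans l≤j′ j′≤j , [ (λ i′<k → inj₁ (≤-<-trans i≤i′ i′<k)) , (λ l<j′ → inj₂ (<-≤-trans l<j′ j′≤j)) ] strict

module XE (n : ℕ) (a : ℕ → ℕ) (a>0 : ∀ i → 1 ≤ i → i < n → 0 < a i)
            (E : ℕ → ℕ → Bool) (E⊆R : InR n E) (E∈Rp : InRp E)
            (x : Point) (xE : IsXE n a E x) where

  open Potentials a x

  InE : Pair → Set
  InE (k , l) = E k l ≡ true

  isE? : Decidable InE
  isE? (k , l) = E k l BoolP.≟ true

  lo hi : Pair → ℤ
  lo (k , l) = row k (pred l)
  hi (k , l) = row k l

  open Telescope lo hi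

  x-off : ∀ {k l} → Valid n (k , l) → E k l ≡ false → x k l ≡ 0ℤ
  x-off {k} {l} = proj₁ xE k l

  P-strict : ∀ {s t} → 1 ≤ s → s < t → t ≤ n → P s <ℤ P t
  P-strict 1≤s s<t t≤n = P-< s<t (a>0 _ 1≤s (<-≤-trans s<t t≤n))

  E-overlap : ∀ {i j k l} → E i j ≡ true → E k l ≡ true → i ≤ k → k ≤ j → j ≤ l → E k j ≡ true
  E-overlap {i} {j} {k} {l} e e′ i≤k k≤j j≤l =
    subst₂ (λ p q → E p q ≡ true) (m≤n⇒m⊔n≡n i≤k) (m≤n⇒m⊓n≡m j≤l)
      (E∈Rp i j k l e e′ (subst₂ _≤_ (sym (m≤n⇒m⊔n≡n i≤k)) (sym (m≤n⇒m⊓n≡m j≤l)) k≤j))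

  lo+x≡hi : ∀ {k l} → k < l → lo (k , l) +ℤ x k l ≡ hi (k , l)
  lo+x≡hi (s≤s k≤c) = sym (row-step k≤c)

  x≡gain : ∀ {k l} → k < l → x k l ≡ gain (k , l)
  x≡gain {k} {l} k<l = trans (shift (lo (k , l)) (x k l)) (cong (_-ℤ lo (k , l)) (lo+x≡hi k<l))
    where
    shift : ∀ p y → y ≡ p +ℤ y -ℤ p
    shift = solve-∀

  lo<hi : ∀ {k l} → k < l → 0ℤ <ℤ x k l → lo (k , l) <ℤ hi (k , l)
  lo<hi {k} {l} k<l x>0 = begin-strict
    lo (k , l)           ≡⟨ sym (ℤP.+-identityʳ _) ⟩
    lo (k , l) +ℤ 0ℤ     <⟨ ℤP.+-monoʳ-< (lo (k , l)) x>0 ⟩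
    lo (k , l) +ℤ x k l  ≡⟨ lo+x≡hi k<l ⟩
    hi (k , l)           ∎
    where open ℤP.≤-Reasoning

  hook-hi : ∀ {k l} → E k l ≡ true → hi (k , l) ≡ col l (suc k)
  hook-hi {k} {l} e = begin
    P k +ℤ R                           ≡⟨ regroup (P k) R C ⟩
    P k +ℤ (R +ℤ C) -ℤ C               ≡⟨ cong (λ z → P k +ℤ z -ℤ C) (trans (sym (S-hook x k l)) (proj₂ xE k l e)) ⟩
    P k +ℤ + sumFrom a k (l ∸ k) -ℤ C  ≡⟨ cong (_-ℤ C) (P-span (<⇒≤ (proj₁ (proj₂ (E⊆R k l e))))) ⟩
    P l -ℤ C                           ≡⟨ cong (λ m → P l -ℤ sumFromℤ (λ t → x t l) (suc k) m) l∸k∸1 ⟩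
    col l (suc k)                      ∎
    where
    open ≡-Reasoning
    R C : ℤ
    R = sumFromℤ (x k) (suc k) (l ∸ k)
    C = sumFromℤ (λ t → x t l) (suc k) (l ∸ k ∸ 1)
    l∸k∸1 : l ∸ k ∸ 1 ≡ l ∸ suc k
    l∸k∸1 = trans (∸-+-assoc l k 1) (cong (l ∸_) (+-comm k 1))
    regroup : ∀ p r c → p +ℤ r ≡ p +ℤ (r +ℤ c) -ℤ c
    regroup = solve-∀

  hook-lo : ∀ {k l} → E k l ≡ true → lo (k , l) ≡ col l k
  hook-lo {k} {l} e = ∙-cancelʳ (x k l) (lo (k , l)) (col l k)
    (trans (lo+x≡hi k<l) (trans (hook-hi e) (col-step k<l)))
    where
    k<l : k < l
    k<l = proj₁ (proj₂ (E⊆R k l e))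

  PositiveInside : Pair → Set
  PositiveInside s = ∀ {k l} → E k l ≡ true → (k , l) ⊏ s → 0ℤ <ℤ x k l

  inside-mono : ∀ {i j i′ j′} → i ≤ i′ → j′ ≤ j → PositiveInside (i , j) → PositiveInside (i′ , j′)
  inside-mono i≤i′ j′≤j pos e inside = pos e (⊏-widen i≤i′ j′≤j inside)

  nonneg-inside : ∀ {s k l} → PositiveInside s → Valid n (k , l) → (k , l) ⊏ s → 0ℤ ≤ℤ x k l
  nonneg-inside {k = k} {l} pos v inside with E k l in e
  ... | true  = ℤP.<⇒≤ (pos e inside)
  ... | false = ℤP.≤-reflexive (sym (x-off v e))

  RowEnd : ℕ → ℕ → Set
  RowEnd i c = c ≡ i ⊎ E i c ≡ true

  ColEnd : ℕ → ℕ → Set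
  ColEnd r j = r ≡ j ⊎ E r j ≡ true

  rowEnd-≤ : ∀ {i c} → RowEnd i c → i ≤ c
  rowEnd-≤ (inj₁ refl) = ≤-refl
  rowEnd-≤ {i} {c} (inj₂ e) = <⇒≤ (proj₁ (proj₂ (E⊆R i c e)))

  colEnd-≤ : ∀ {r j} → ColEnd r j → r ≤ j
  colEnd-≤ (inj₁ refl) = ≤-refl
  colEnd-≤ {r} {j} (inj₂ e) = <⇒≤ (proj₁ (proj₂ (E⊆R r j e)))

  rowEnd-E : ∀ {i c} → RowEnd i c → i < c → E i c ≡ true
  rowEnd-E (inj₁ refl) i<i = ⊥-elim (<-irrefl refl i<i)
  rowEnd-E (inj₂ e)    _   = e

  colEnd-E : ∀ {r j} → ColEnd r j → r < j → E r j ≡ true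
  colEnd-E (inj₁ refl) r<r = ⊥-elim (<-irrefl refl r<r)
  colEnd-E (inj₂ e)    _   = e

  row-last-end : ∀ {i c} → 1 ≤ i → c ≤ n → i ≤ c → ∃[ c′ ] c′ ≤ c × RowEnd i c′ × row i c ≡ row i c′
  row-last-end {i} 1≤i c≤n i≤c = go (≤⇒≤′ i≤c) c≤n
    where
    go : ∀ {c} → i ≤′ c → c ≤ n → ∃[ c′ ] c′ ≤ c × RowEnd i c′ × row i c ≡ row i c′
    go ≤′-refl _ = i , ≤-refl , inj₁ refl , refl
    go (≤′-step {c} i≤′c) c<n with E i (suc c) in e | go i≤′c (<⇒≤ c<n)
    ... | true  | _                   = suc c , ≤-refl , inj₂ e , refl
    ... | false | c′ , c′≤c , end , eq = c′ , m≤n⇒m≤1+n c′≤c , end , (begin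
      row i (suc c)           ≡⟨ row-step (≤′⇒≤ i≤′c) ⟩
      row i c +ℤ x i (suc c)  ≡⟨ cong (row i c +ℤ_) (x-off (1≤i , s≤s (≤′⇒≤ i≤′c) , c<n) e) ⟩
      row i c +ℤ 0ℤ           ≡⟨ ℤP.+-identityʳ _ ⟩
      row i c                 ≡⟨ eq ⟩
      row i c′                ∎)
      where open ≡-Reasoning

  col-first-end : ∀ {r j} → 1 ≤ r → r ≤ j → j ≤ n → ∃[ r′ ] r ≤ r′ × ColEnd r′ j × col j r ≡ col j r′
  col-first-end {r} {j} 1≤r r≤j j≤n = go (j ∸ r) 1≤r (m+[n∸m]≡n r≤j)
    where
    go : ∀ g {r} → 1 ≤ r → r + g ≡ j → ∃[ r′ ] r ≤ r′ × ColEnd r′ j × col j r ≡ col j r′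
    go zero    {r} _   r+0≡j = r , ≤-refl , inj₁ (trans (sym (+-identityʳ r)) r+0≡j) , refl
    go (suc g) {r} 1≤r r+g≡j with E r j in e | go g (≤-trans 1≤r (n≤1+n r)) (trans (sym (+-suc r g)) r+g≡j)
    ... | true  | _                   = r , ≤-refl , inj₂ e , refl
    ... | false | r′ , r<r′ , end , eq = r′ , <⇒≤ r<r′ , end , (begin
      col j r            ≡⟨ sym (ℤP.+-identityʳ _) ⟩
      col j r +ℤ 0ℤ      ≡⟨ cong (col j r +ℤ_) (sym (x-off (1≤r , r<j , j≤n) e)) ⟩
      col j r +ℤ x r j   ≡⟨ sym (col-step r<j) ⟩
      col j (suc r)      ≡⟨ eq ⟩
      col j r′           ∎)
      where
      open ≡-Reasoning
      r<j : r < j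
      r<j = subst (r <_) r+g≡j (m<m+n r (s≤s z≤n))

  rowEnd≤P : ∀ {i c} → PositiveInside (i , c) → RowEnd i c → row i c ≤ℤ P c
  rowEnd≤P {i} pos (inj₁ refl) = ℤP.≤-reflexive (row-base i)
  rowEnd≤P {i} {c} pos (inj₂ e) with E⊆R i c e
  ... | _ , i<c , c≤n = begin
    row i c          ≡⟨ hook-hi e ⟩
    col c (suc i)    ≤⟨ col-mono nonneg i<c ≤-refl ⟩
    col c c          ≡⟨ col-base c ⟩
    P c              ∎
    where
    open ℤP.≤-Reasoning
    nonneg : ∀ {t} → suc i ≤ t → t < c → 0ℤ ≤ℤ x t c
    nonneg i<t t<c = nonneg-inside pos (≤-trans (s≤s z≤n) i<t , t<c , c≤n) (<⇒≤ i<t , ≤-refl , inj₁ i<t)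

  P≤colEnd : ∀ {r j} → PositiveInside (r , j) → ColEnd r j → P r ≤ℤ col j r
  P≤colEnd {r} pos (inj₁ refl) = ℤP.≤-reflexive (sym (col-base r))
  P≤colEnd {r} {j} pos (inj₂ e) with E⊆R r j e
  ... | 1≤r , r<j , j≤n = begin
    P r              ≡⟨ sym (row-base r) ⟩
    row r r          ≤⟨ row-mono nonneg ≤-refl (<⇒≤pred r<j) ⟩
    row r (pred j)   ≡⟨ hook-lo e ⟩
    col j r          ∎
    where
    open ℤP.≤-Reasoning
    nonneg : ∀ {t} → r < t → t ≤ pred j → 0ℤ ≤ℤ x r t
    nonneg r<t t≤ = nonneg-inside pos (1≤r , r<t , ≤-trans (<⇒≤ t<j) j≤n) (≤-refl , <⇒≤ t<j , inj₂ t<j)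
      where
      t<j : _ < j
      t<j = ≤pred⇒< r<j t≤

  hi≤lo-same-row : ∀ {k l l′} → PositiveInside (k , l′) → E k l ≡ true → E k l′ ≡ true → l < l′ →
             hi (k , l) ≤ℤ lo (k , l′)
  hi≤lo-same-row {k} {l} {l′} pos e e′ l<l′ with E⊆R k l e | E⊆R k l′ e′
  ... | 1≤k , k<l , _ | _ , _ , l′≤n = row-mono nonneg (<⇒≤ k<l) (<⇒≤pred l<l′)
    where
    nonneg : ∀ {t} → l < t → t ≤ pred l′ → 0ℤ ≤ℤ x k t
    nonneg l<t t≤ = nonneg-inside pos (1≤k , <-trans k<l l<t , ≤-trans (<⇒≤ t<l′) l′≤n) (≤-refl , <⇒≤ t<l′ , inj₂ t<l′)
      where
      t<l′ : _ < l′
      t<l′ = ≤pred⇒< l<l′ t≤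

  hi≤lo-same-col : ∀ {k k′ l} → PositiveInside (k , l) → E k l ≡ true → E k′ l ≡ true → k < k′ →
             hi (k , l) ≤ℤ lo (k′ , l)
  hi≤lo-same-col {k} {k′} {l} pos e e′ k<k′ with E⊆R k′ l e′
  ... | _ , k′<l , l≤n = begin
    hi (k , l)     ≡⟨ hook-hi e ⟩
    col l (suc k)  ≤⟨ col-mono nonneg k<k′ (<⇒≤ k′<l) ⟩
    col l k′       ≡⟨ sym (hook-lo e′) ⟩
    lo (k′ , l)    ∎
    where
    open ℤP.≤-Reasoning
    nonneg : ∀ {t} → suc k ≤ t → t < k′ → 0ℤ ≤ℤ x t l
    nonneg k<t t<k′ = nonneg-inside pos (≤-trans (s≤s z≤n) k<t , <-trans t<k′ k′<l , l≤n) (<⇒≤ k<t , ≤-refl , inj₁ k<t)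

  rowEnd<colEnd : ∀ {i j c r} → Valid n (i , j) → PositiveInside (i , j) → i < r → c < j →
               RowEnd i c → ColEnd r j → row i c <ℤ col j r
  rowEnd<colEnd {i} {j} {c} {r} (1≤i , _ , j≤n) pos i<r c<j end-c end-r with <-cmp c r
  ... | tri< c<r _ _ = begin-strict
    row i c   ≤⟨ rowEnd≤P (inside-mono ≤-refl (<⇒≤ c<j) pos) end-c ⟩
    P c       <⟨ P-strict (≤-trans 1≤i (rowEnd-≤ end-c)) c<r (≤-trans (colEnd-≤ end-r) j≤n) ⟩
    P r       ≤⟨ P≤colEnd (inside-mono (<⇒≤ i<r) ≤-refl pos) end-r ⟩
    col j r   ∎
    where open ℤP.≤-Reasoning
  ... | tri≈ _ refl _ = ⊥-elim (<-irrefl refl (proj₁ (proj₂ (E⊆R c c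
          (E-overlap (rowEnd-E end-c i<r) (colEnd-E end-r c<j) (<⇒≤ i<r) ≤-refl (<⇒≤ c<j))))))
  ... | tri> _ _ r<c = begin-strict
    row i c       ≤⟨ hi≤lo-same-col (inside-mono ≤-refl (<⇒≤ c<j) pos) e-ic e-rc i<r ⟩
    lo (r , c)    <⟨ lo<hi r<c (pos e-rc (<⇒≤ i<r , <⇒≤ c<j , inj₁ i<r)) ⟩
    hi (r , c)    ≤⟨ hi≤lo-same-row (inside-mono (<⇒≤ i<r) ≤-refl pos) e-rc e-rj c<j ⟩
    lo (r , j)    ≡⟨ hook-lo e-rj ⟩
    col j r       ∎
    where
    open ℤP.≤-Reasoning
    e-ic : E i c ≡ true
    e-ic = rowEnd-E end-c (<-trans i<r r<c)
    e-rj : E r j ≡ true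
    e-rj = colEnd-E end-r (<-trans r<c c<j)
    e-rc : E r c ≡ true
    e-rc = E-overlap e-ic e-rj (<⇒≤ i<r) (<⇒≤ r<c) (<⇒≤ c<j)

  positive-step : ∀ {i j} → E i j ≡ true → PositiveInside (i , j) → 0ℤ <ℤ x i j
  positive-step {i} {j} e pos with E⊆R i j e
  ... | valid@(1≤i , i<j , j≤n)
      with row-last-end 1≤i (≤-trans pred[n]≤n j≤n) (<⇒≤pred i<j) | col-first-end (s≤s z≤n) i<j j≤n
  ... | c , c≤ , end-c , row≡ | r , i<r , end-r , col≡ = 0<-of-+ (lo+x≡hi i<j) (begin-strict
    lo (i , j)     ≡⟨ row≡ ⟩
    row i c        <⟨ rowEnd<colEnd valid pos i<r (≤pred⇒< i<j c≤) end-c end-r ⟩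
    col j r        ≡⟨ sym col≡ ⟩
    col j (suc i)  ≡⟨ sym (hook-hi e) ⟩
    hi (i , j)     ∎)
    where open ℤP.≤-Reasoning

  positive : ∀ {i j} → E i j ≡ true → 0ℤ <ℤ x i j
  positive {i} {j} = by-length (j ∸ i) refl
    where
    by-length : ∀ m {i j} → j ∸ i ≡ m → E i j ≡ true → 0ℤ <ℤ x i j
    by-length = <-rec (λ m → ∀ {i j} → j ∸ i ≡ m → E i j ≡ true → 0ℤ <ℤ x i j)
      λ m shorter len e → positive-step e λ {k} {l} e′ inside →
        shorter (subst (l ∸ k <_) len (⊏-shorter (<⇒≤ (proj₁ (proj₂ (E⊆R k l e′)))) inside)) refl e′

  positive-inside : ∀ {s} → PositiveInside s
  positive-inside e _ = positive e

  P≤lo : ∀ {k l} → E k l ≡ true → P k ≤ℤ lo (k , l)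
  P≤lo e = ℤP.≤-trans (P≤colEnd positive-inside (inj₂ e)) (ℤP.≤-reflexive (sym (hook-lo e)))

  hi≤P : ∀ {k l} → E k l ≡ true → hi (k , l) ≤ℤ P l
  hi≤P e = rowEnd≤P positive-inside (inj₂ e)

  P-bounds-<ʳ : ∀ {k l s t} → E k l ≡ true → s ≤ k → l < t → t ≤ n → P s ≤ℤ lo (k , l) × hi (k , l) <ℤ P t
  P-bounds-<ʳ {k} {l} e s≤k l<t t≤n with E⊆R k l e
  ... | 1≤k , k<l , _ = ℤP.≤-trans (P-mono s≤k) (P≤lo e)
                      , ℤP.≤-<-trans (hi≤P e) (P-strict (≤-trans 1≤k (<⇒≤ k<l)) l<t t≤n)

  P-bounds-<ˡ : ∀ {k l s t} → E k l ≡ true → 1 ≤ s → s < k → l ≤ t → P s <ℤ lo (k , l) × hi (k , l) ≤ℤ P t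
  P-bounds-<ˡ {k} {l} e 1≤s s<k l≤t with E⊆R k l e
  ... | _ , k<l , l≤n = ℤP.<-≤-trans (P-strict 1≤s s<k (≤-trans (<⇒≤ k<l) l≤n)) (P≤lo e)
                      , ℤP.≤-trans (hi≤P e) (P-mono l≤t)

  ≪⇒hi<lo : ∀ {k l k′ l′} → E k l ≡ true → E k′ l′ ≡ true → (k , l) ≪ (k′ , l′) →
              hi (k , l) <ℤ lo (k′ , l′)
  ≪⇒hi<lo {k} {l} {k′} {l′} e e′ (k<k′ , l<l′) with E⊆R k l e | E⊆R k′ l′ e′
  ... | 1≤k , k<l , _ | _ , _ , l′≤n = begin-strict
    hi (k , l)    <⟨ rowEnd<colEnd (1≤k , <-trans k<l l<l′ , l′≤n) positive-inside k<k′ l<l′ (inj₂ e) (inj₂ e′) ⟩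
    col l′ k′     ≡⟨ sym (hook-lo e′) ⟩
    lo (k′ , l′)  ∎
    where open ℤP.≤-Reasoning

  ≺⇒hi≤lo : ∀ {e f} → e ≺ f → InE e → InE f → hi e ≤ℤ lo f
  ≺⇒hi≤lo {k , l} {k′ , l′} ((k≤k′ , l≤l′) , rank<) e e′ with m≤n⇒m<n∨m≡n k≤k′ | m≤n⇒m<n∨m≡n l≤l′
  ... | inj₁ k<k′ | inj₁ l<l′ = ℤP.<⇒≤ (≪⇒hi<lo e e′ (k<k′ , l<l′))
  ... | inj₁ k<k′ | inj₂ refl = hi≤lo-same-col positive-inside e e′ k<k′
  ... | inj₂ refl | inj₁ l<l′ = hi≤lo-same-row positive-inside e e′ l<l′
  ... | inj₂ refl | inj₂ refl = ⊥-elim (<-irrefl refl rank<)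

  ordered⇒Chain : ∀ {d} → AllPairs _≺_ d → Chain (filter isE? d)
  ordered⇒Chain {d} ordered = go (AllPairsP.filter⁺ isE? ordered) (all-filter isE? d)
    where
    go : ∀ {es} → AllPairs _≺_ es → All InE es → Chain es
    go []          []       = []
    go (e≺ ∷ ord)  (e ∷ es) = All.zipWith (λ (e≺f , f) → ≺⇒hi≤lo e≺f e f) (e≺ , es) ∷ go ord es

  S≡Σgain : ∀ {d} → All (Valid n) d → S x d ≡ Σgain (filter isE? d)
  S≡Σgain [] = refl
  S≡Σgain {(k , l) ∷ d} (v ∷ vs) with isE? (k , l)
  ... | yes _ = cong₂ _+ℤ_ (x≡gain (proj₁ (proj₂ v))) (S≡Σgain vs)
  ... | no ¬e = trans (cong₂ _+ℤ_ (x-off v (BoolP.¬-not ¬e)) (S≡Σgain vs)) (ℤP.+-identityˡ _)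

  P+M≡P : ∀ {d} (sp : Span n d) → let open Span sp in P from +ℤ + M a d ≡ P (suc to)
  P+M≡P sp = trans (cong (λ m → P from +ℤ + m) (trans (M-span a) (cong (sumFrom a from) (sym (+-∸-assoc 1 from≤to)))))
                    (P-span (m≤n⇒m≤1+n from≤to))
    where open Span sp

  gap-at-corner : ∀ {d v} (sp : Span n d) → v ∈ d → Corner d v → ¬ InE v →
                  let open Span sp in P from +ℤ S x d <ℤ P (suc to)
  gap-at-corner {v = v} sp v∈ c v∉E with split-at-corner (Span.ordered sp) v∈ c
  ... | pre , post , refl , pre≼ , post≽ = begin-strict
    P from +ℤ S x (pre ++ v ∷ post)                  ≡⟨ cong (P from +ℤ_) (S≡Σgain valid) ⟩
    P from +ℤ Σgain (filter isE? (pre ++ v ∷ post))  ≡⟨ cong (λ es → P from +ℤ Σgain es) split ⟩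
    P from +ℤ Σgain (es ++ fs)                       <⟨ telescope-< es fs (subst Chain split (ordered⇒Chain ordered))
                                                          (P-strict 1≤from (s≤s from≤to) to<n) es-bounds fs-bounds cross ⟩
    P (suc to)                                       ∎
    where
    open ℤP.≤-Reasoning
    open Span sp
    open Corner c
    es fs : List Pair
    es = filter isE? pre
    fs = filter isE? post
    split : filter isE? (pre ++ v ∷ post) ≡ es ++ fs
    split = trans (filter-++ isE? pre (v ∷ post)) (cong (es ++_) (filter-reject isE? v∉E))
    es-bounds : ∀ {e} → e ∈ es → P from ≤ℤ lo e × hi e <ℤ P (suc to)
    es-bounds e∈ with ∈-filter⁻ isE? e∈
    ... | e∈pre , e = P-bounds-<ʳ e (proj₁ (within (∈-++⁺ˡ e∈pre)))
      (≤-<-trans (proj₂ (All.lookup pre≼ e∈pre)) (<-≤-trans (proj₂ before≪after) (proj₂ (within after∈)))) to<n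
    fs-bounds : ∀ {f} → f ∈ fs → P from <ℤ lo f × hi f ≤ℤ P (suc to)
    fs-bounds f∈ with ∈-filter⁻ isE? f∈
    ... | f∈post , f = P-bounds-<ˡ f 1≤from
      (≤-<-trans (proj₁ (within before∈)) (<-≤-trans (proj₁ before≪after) (proj₁ (All.lookup post≽ f∈post))))
      (proj₂ (within (∈-++⁺ʳ pre (there f∈post))))
    cross : ∀ {e f} → e ∈ es → f ∈ fs → hi e <ℤ lo f
    cross e∈ f∈ with ∈-filter⁻ isE? e∈ | ∈-filter⁻ isE? f∈
    ... | e∈pre , e | f∈post , f =
      ≪⇒hi<lo e f (≼-≪-≼ (All.lookup pre≼ e∈pre) before≪after (All.lookup post≽ f∈post))

  corner-in-E : ∀ {d i j} → IsDyck n d → S x d ≡ + M a d → Peak d i j ⊎ Valley d i j → E i j ≡ true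
  corner-in-E {d} {i} {j} dyck S≡M pv with E i j in e
  ... | true  = refl
  ... | false = ⊥-elim (ℤP.<-irrefl (P+M≡P sp) (subst (λ s → P from +ℤ s <ℤ P (suc to)) S≡M
                  (gap-at-corner sp v∈ (corner (proj₁ v-valid) (proj₁ (proj₂ v-valid)) pv) (BoolP.not-¬ e))))
    where
    sp : Span n d
    sp = span dyck
    open Span sp
    v∈ : (i , j) ∈ d
    v∈ = [ proj₁ , proj₁ ] pv
    v-valid : Valid n (i , j)
    v-valid = All.lookup valid v∈

lemma4p3 : (n : ℕ) → 2 ≤ n → (a : ℕ → ℕ) → (∀ i → 1 ≤ i → i < n → 0 < a i)
    → (E : ℕ → ℕ → Bool) → InR n E → InRp E
    → (x : Point) → IsXE n a E x
    → (∀ i j → E i j ≡ true → + 0 <ℤ x i j)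
      × (∀ (d : List Pair) → IsDyck n d → S x d ≡ + M a d
         → ∀ i j → Peak d i j ⊎ Valley d i j → E i j ≡ true)
lemma4p3 n _ a a>0 E E⊆R E∈Rp x xE = (λ _ _ → positive) , (λ _ dyck S≡M _ _ → corner-in-E dyck S≡M)
  where open XE n a a>0 E E⊆R E∈Rp x xE
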